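{- For every $n \geq 1$ and every string $T$ of length $n$, $\mathsf{e}(T[2..n]) - \mathsf{e}(T) \leq \mathsf{e}(T) - 2$. That is, the worst-case additive sensitivity of the CDAWG size under left-end deletion is at most $\mathsf{e}-2$.
   Context: Strings are finite sequences of characters from an alphabet $\Sigma$; $\varepsilon$ is the empty string, $T[i..j]=T[i]\cdots T[j]$ (and $T[2..1]=\varepsilon$). For a string $T$, $\mathrm{Substr}(T)$ is its set of substrings (including $\varepsilon$). A substring $u$ of $T$ is left-maximal in $T$ if $u$ is a prefix of $T$ or there are distinct characters $c \neq d$ with $cu, du \in \mathrm{Substr}(T)$; it is right-maximal in $T$ if $u$ is a suffix of $T$ or there are distinct characters $c\neq d$ with $uc, ud \in \mathrm{Substr}(T)$. $\mathsf{M}(T)$ is the set of substrings of $T$ that are both left- and right-maximal (it contains $\varepsilon$ and $T$). The compact directed acyclic word graph $\mathrm{CDAWG}(T)$ has exactly one node for each element of $\mathsf{M}(T)$, and the outgoing edges of the node $x$ are in bijection with the characters $c$ such that $xc \in \mathrm{Substr}(T)$. For a string $w$, $d_T(w)$ is the number of distinct characters $c$ with $wc \in \mathrm{Substr}(T)$. The size of the CDAWG is $\mathsf{e}(T) = \sum_{x \in \mathsf{M}(T)} d_T(x)$, its number of edges. -}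

module Defs where

open import Data.List using (List; []; _∷_; _++_; _∷ʳ_; length)
open import Data.List.Membership.Propositional using (_∈_)
open import Data.List.Relation.Unary.Unique.Propositional using (Unique)
open import Data.Nat using (ℕ)
open import Data.Product using (Σ; ∃; ∃₂; _×_; _,_)
open import Data.Sum using (_⊎_)
open import Function.Bundles using (_⇔_)
open import Relation.Binary.PropositionalEquality using (_≡_; _≢_)

module _ {A : Set} where

  Substr : List A → List A → Set
  Substr u T = ∃₂ λ xs ys → xs ++ u ++ ys ≡ T

  Prefix : List A → List A → Set
  Prefix u T = ∃ λ ys → u ++ ys ≡ T

  Suffix : List A → List A → Set
  Suffix u T = ∃ λ xs → xs ++ u ≡ T

  LeftMaximal : List A → List A → Set
  LeftMaximal u T =
    Prefix u T ⊎ ∃₂ λ c d → c ≢ d × Substr (c ∷ u) T × Substr (d ∷ u) T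

  RightMaximal : List A → List A → Set
  RightMaximal u T =
    Suffix u T ⊎ ∃₂ λ c d → c ≢ d × Substr (u ∷ʳ c) T × Substr (u ∷ʳ d) T

  Maximal : List A → List A → Set
  Maximal u T = Substr u T × LeftMaximal u T × RightMaximal u T

  -- edges of CDAWG(T): pairs (x , c) with x ∈ M(T) and xc ∈ Substr(T)
  Edge : List A → (List A × A) → Set
  Edge T (x , c) = Maximal x T × Substr (x ∷ʳ c) T

  EdgeCount : List A → ℕ → Set
  EdgeCount T k =
    Σ (List (List A × A)) λ L →
      Unique L × length L ≡ k × (∀ p → (p ∈ L) ⇔ Edge T p)

-- Let T = a ∷ S. A CDAWG edge (x , c) of S is still an edge of T when x stays
-- left-maximal in T. Otherwise x is a prefix of S that is only ever preceded
-- by a in T, and then (a ∷ x , c) is an edge of T. Hence every edge of S is an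
-- edge of T or an edge of T out of a non-root node with its first letter
-- dropped, so e(S) ≤ 2 e(T) − σ, where σ is the number of root edges of T,
-- i.e. the number of distinct letters of T. If σ ≥ 2 this is the claim; if T
-- is unary only the second case occurs and e(S) ≤ e(T) − 1.
module Submission where

open import Defs
open import Data.Empty using (⊥-elim)
open import Data.Integer using (+_; _-_; _⊖_) renaming (_≤_ to _≤ℤ_)
import Data.Integer.Properties as ℤ
open import Data.List using (List; []; _∷_; [_]; _++_; _∷ʳ_; length; drop; initLast; _∷ʳ′_)
open import Data.List.Membership.Propositional using (_∈_; find)
open import Data.List.Membership.Propositional.Properties using (∈-++⁺ˡ; ∈-++⁺ʳ; ∈-∃++; ∈-length)
open import Data.List.Properties using (++-assoc; ++-identityʳ; length-++; length-removeAt′)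
open import Data.List.Relation.Binary.Subset.Propositional using (_⊆_)
open import Data.List.Relation.Unary.All as All using (All; []; _∷_)
open import Data.List.Relation.Unary.All.Properties using (¬Any⇒All¬)
open import Data.List.Relation.Unary.AllPairs using ([]; _∷_)
open import Data.List.Relation.Unary.Any using (Any; here; there; index; _─_)
open import Data.List.Relation.Unary.Unique.Propositional using (Unique)
open import Data.Nat using (ℕ; suc; _+_; _≤_; z≤n; s≤s)
import Data.Nat.Properties as ℕ
open import Data.Product using (∃; ∃₂; _×_; _,_)
open import Data.Sum using (_⊎_; inj₁; inj₂)
open import Effect.Monad using (RawMonad)
open import Function using (_∘_)
open import Function.Bundles using (_⇔_; Equivalence)
open import Level using (0ℓ)
open import Relation.Nullary using (¬_; Dec; yes; no)
open import Relation.Nullary.Decidable using (decidable-stable; ¬¬-excluded-middle)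
open import Relation.Nullary.Negation using (¬¬-Monad; contradiction)
open import Relation.Binary.PropositionalEquality using (_≡_; _≢_; refl; sym; trans; cong; module ≡-Reasoning)

-- The alphabet has no decidable equality, so the counting argument runs in the
-- double-negation monad; its conclusion, an inequality of naturals, is stable.
open RawMonad (¬¬-Monad {0ℓ})

private variable
  A : Set
  a b c z : A
  u w x xs ys r S T : List A

∈-─ : (b∈ys : b ∈ ys) → z ∈ ys → z ≢ b → z ∈ (ys ─ b∈ys)
∈-─ (here refl)  (here refl)  z≢b = contradiction refl z≢b
∈-─ (here refl)  (there z∈ys) _   = z∈ys
∈-─ (there _)    (here refl)  _   = here refl
∈-─ (there b∈ys) (there z∈ys) z≢b = there (∈-─ b∈ys z∈ys z≢b)

Unique-⊆⇒length≤ : Unique xs → xs ⊆ ys → length xs ≤ length ys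
Unique-⊆⇒length≤ [] _ = z≤n
Unique-⊆⇒length≤ {xs = b ∷ xs} {ys} (b∉xs ∷ unique) xs⊆ys = begin
  suc (length xs)           ≤⟨ s≤s (Unique-⊆⇒length≤ unique xs⊆ys─b) ⟩
  suc (length (ys ─ b∈ys))  ≡⟨ length-removeAt′ ys (index b∈ys) ⟨
  length ys                 ∎
  where
  open ℕ.≤-Reasoning
  b∈ys = xs⊆ys (here refl)
  xs⊆ys─b : xs ⊆ (ys ─ b∈ys)
  xs⊆ys─b z∈xs = ∈-─ b∈ys (xs⊆ys (there z∈xs)) (λ z≡b → All.lookup b∉xs z∈xs (sym z≡b))

¬¬-⊆ : (∀ {z} → z ∈ xs → ¬ ¬ z ∈ ys) → ¬ ¬ xs ⊆ ys
¬¬-⊆ {xs = []}    _     = return λ ()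
¬¬-⊆ {xs = _ ∷ _} ¬¬xs⊆ = do
  b∈ys  ← ¬¬xs⊆ (here refl)
  xs⊆ys ← ¬¬-⊆ (λ z∈xs → ¬¬xs⊆ (there z∈xs))
  return λ { (here refl) → b∈ys ; (there z∈xs) → xs⊆ys z∈xs }

∷≡∷ʳ : (a : A) (xs : List A) → ∃₂ λ ys b → a ∷ xs ≡ ys ∷ʳ b
∷≡∷ʳ a xs with initLast xs
... | []        = [] , a , refl
... | ys ∷ʳ′ b  = a ∷ ys , b , refl

Substr-∷ : Substr u S → Substr u (a ∷ S)
Substr-∷ {a = a} (xs , ys , eq) = a ∷ xs , ys , cong (a ∷_) eq

Substr-∷⇒∈ : Substr (b ∷ u) T → b ∈ T
Substr-∷⇒∈ (xs , _ , refl) = ∈-++⁺ʳ xs (here refl)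

∈⇒Substr : b ∈ T → Substr [ b ] T
∈⇒Substr b∈T with xs , ys , eq ← ∈-∃++ b∈T = xs , ys , sym eq

Prefix⇒Substr : Prefix u T → Substr u T
Prefix⇒Substr (ys , eq) = [] , ys , eq

Prefix-∷ : Prefix u S → Prefix (a ∷ u) (a ∷ S)
Prefix-∷ {a = a} (ys , eq) = ys , cong (a ∷_) eq

RightMaximal-∷ : RightMaximal u S → RightMaximal u (a ∷ S)
RightMaximal-∷ {a = a} (inj₁ (xs , eq))           = inj₁ (a ∷ xs , cong (a ∷_) eq)
RightMaximal-∷ (inj₂ (c , d , c≢d , uc∈S , ud∈S)) = inj₂ (c , d , c≢d , Substr-∷ uc∈S , Substr-∷ ud∈S)

Edge-root : c ∈ T → Edge T ([] , c)
Edge-root {T = T} c∈T = (Prefix⇒Substr ε⊑T , inj₁ ε⊑T , inj₁ (T , ++-identityʳ T)) , ∈⇒Substr c∈T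
  where ε⊑T = T , refl

Edge-∷ : Edge S (x , c) → LeftMaximal x (a ∷ S) → Edge (a ∷ S) (x , c)
Edge-∷ ((x∈S , _ , rm) , xc∈S) lm = (Substr-∷ x∈S , lm , RightMaximal-∷ rm) , Substr-∷ xc∈S

PrecededOnlyBy : A → List A → List A → Set
PrecededOnlyBy a x T = ∀ b → Substr (b ∷ x) T → ¬ ¬ b ≡ a

occurrence-∷ˡ : PrecededOnlyBy a x (a ∷ S) → xs ++ x ++ r ≡ S →
                ¬ ¬ (∃ λ ys → ys ++ a ∷ x ++ r ≡ a ∷ S)
occurrence-∷ˡ {a = a} {x = x} {S = S} {xs = xs} {r = r} onlyA eq
  with ys , b , a∷xs≡ys∷ʳb ← ∷≡∷ʳ a xs = do
    refl ← onlyA b (ys , r , occurrence)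
    return (ys , occurrence)
  where
  open ≡-Reasoning
  occurrence : ys ++ b ∷ x ++ r ≡ a ∷ S
  occurrence = begin
    ys ++ b ∷ x ++ r      ≡⟨ ++-assoc ys [ b ] (x ++ r) ⟨
    (ys ∷ʳ b) ++ x ++ r   ≡⟨ cong (_++ x ++ r) a∷xs≡ys∷ʳb ⟨
    a ∷ xs ++ x ++ r      ≡⟨ cong (a ∷_) eq ⟩
    a ∷ S                 ∎

Substr-∷ˡ : PrecededOnlyBy a x (a ∷ S) → Substr (x ++ w) S → ¬ ¬ Substr (a ∷ x ++ w) (a ∷ S)
Substr-∷ˡ {a = a} {x = x} {w = w} onlyA (xs , ys , eq) = do
  zs , eq′ ← occurrence-∷ˡ {xs = xs} onlyA (trans (cong (xs ++_) (sym (++-assoc x w ys))) eq)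
  return (zs , ys , trans (cong (λ v → zs ++ a ∷ v) (++-assoc x w ys)) eq′)

Suffix-∷ˡ : PrecededOnlyBy a x (a ∷ S) → Suffix x S → ¬ ¬ Suffix (a ∷ x) (a ∷ S)
Suffix-∷ˡ {a = a} {x = x} onlyA (xs , eq) = do
  zs , eq′ ← occurrence-∷ˡ {xs = xs} onlyA (trans (cong (xs ++_) (++-identityʳ x)) eq)
  return (zs , trans (cong (λ v → zs ++ a ∷ v) (sym (++-identityʳ x))) eq′)

RightMaximal-∷ˡ : PrecededOnlyBy a x (a ∷ S) → RightMaximal x S → ¬ ¬ RightMaximal (a ∷ x) (a ∷ S)
RightMaximal-∷ˡ onlyA (inj₁ x⊒S) = inj₁ <$> Suffix-∷ˡ onlyA x⊒S
RightMaximal-∷ˡ onlyA (inj₂ (c , d , c≢d , xc∈S , xd∈S)) = do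
  axc∈T ← Substr-∷ˡ onlyA xc∈S
  axd∈T ← Substr-∷ˡ onlyA xd∈S
  return (inj₂ (c , d , c≢d , axc∈T , axd∈T))

Edge-∷ˡ : PrecededOnlyBy a x (a ∷ S) → Prefix x S → Edge S (x , c) → ¬ ¬ Edge (a ∷ S) (a ∷ x , c)
Edge-∷ˡ onlyA x⊑S ((_ , _ , rm) , xc∈S) = do
  rm′    ← RightMaximal-∷ˡ onlyA rm
  axc∈T  ← Substr-∷ˡ onlyA xc∈S
  return ((Prefix⇒Substr (Prefix-∷ x⊑S) , inj₁ (Prefix-∷ x⊑S) , rm′) , axc∈T)

¬LeftMaximal-∷⇒Prefix : ¬ LeftMaximal x (a ∷ S) → LeftMaximal x S → Prefix x S
¬LeftMaximal-∷⇒Prefix _ (inj₁ x⊑S) = x⊑S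
¬LeftMaximal-∷⇒Prefix ¬lm (inj₂ (c , d , c≢d , cx∈S , dx∈S)) =
  contradiction (inj₂ (c , d , c≢d , Substr-∷ cx∈S , Substr-∷ dx∈S)) ¬lm

¬LeftMaximal-∷⇒PrecededOnlyBy : ¬ LeftMaximal x (a ∷ S) → Prefix x S → PrecededOnlyBy a x (a ∷ S)
¬LeftMaximal-∷⇒PrecededOnlyBy {a = a} ¬lm x⊑S b bx∈T b≢a =
  ¬lm (inj₂ (b , a , b≢a , bx∈T , Prefix⇒Substr (Prefix-∷ x⊑S)))

Edge-∷⁺ : Edge S (x , c) → ¬ ¬ (Edge (a ∷ S) (x , c) ⊎ Edge (a ∷ S) (a ∷ x , c))
Edge-∷⁺ e@((_ , lmS , _) , _) = ¬¬-excluded-middle >>= λ where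
  (yes lm) → return (inj₁ (Edge-∷ e lm))
  (no ¬lm) → let x⊑S = ¬LeftMaximal-∷⇒Prefix ¬lm lmS in
    inj₂ <$> Edge-∷ˡ (¬LeftMaximal-∷⇒PrecededOnlyBy ¬lm x⊑S) x⊑S e

module _ (unary : All (λ t → ¬ ¬ t ≡ a) S) where

  unary⇒PrecededOnlyBy : PrecededOnlyBy a x (a ∷ S)
  unary⇒PrecededOnlyBy b bx∈T with Substr-∷⇒∈ bx∈T
  ... | here refl  = return refl
  ... | there b∈S  = All.lookup unary b∈S

  unary⇒Prefix : LeftMaximal x S → Prefix x S
  unary⇒Prefix (inj₁ x⊑S) = x⊑S
  unary⇒Prefix (inj₂ (c , d , c≢d , cx∈S , dx∈S)) =
    ⊥-elim (All.lookup unary (Substr-∷⇒∈ cx∈S) λ c≡a →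
            All.lookup unary (Substr-∷⇒∈ dx∈S) λ d≡a → c≢d (trans c≡a (sym d≡a)))

  Edge-∷⁺-unary : Edge S (x , c) → ¬ ¬ Edge (a ∷ S) (a ∷ x , c)
  Edge-∷⁺-unary e@((_ , lmS , _) , _) = Edge-∷ˡ unary⇒PrecededOnlyBy (unary⇒Prefix lmS) e

shortenedEdges : List (List A × A) → List (List A × A)
shortenedEdges []                = []
shortenedEdges (([] , _) ∷ L)    = shortenedEdges L
shortenedEdges ((_ ∷ x , c) ∷ L) = (x , c) ∷ shortenedEdges L

rootLetters : List (List A × A) → List A
rootLetters []                = []
rootLetters (([] , c) ∷ L)    = c ∷ rootLetters L
rootLetters ((_ ∷ _ , _) ∷ L) = rootLetters L

length-shortenedEdges+rootLetters : (L : List (List A × A)) →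
  length (shortenedEdges L) + length (rootLetters L) ≡ length L
length-shortenedEdges+rootLetters []                = refl
length-shortenedEdges+rootLetters (([] , _) ∷ L)    =
  trans (ℕ.+-suc (length (shortenedEdges L)) _) (cong suc (length-shortenedEdges+rootLetters L))
length-shortenedEdges+rootLetters ((_ ∷ _ , _) ∷ L) = cong suc (length-shortenedEdges+rootLetters L)

∈-shortenedEdges : {L : List (List A × A)} → (b ∷ x , c) ∈ L → (x , c) ∈ shortenedEdges L
∈-shortenedEdges (here refl)                     = here refl
∈-shortenedEdges {L = ([] , _) ∷ _}    (there p∈L) = ∈-shortenedEdges p∈L
∈-shortenedEdges {L = (_ ∷ _ , _) ∷ _} (there p∈L) = there (∈-shortenedEdges p∈L)

∈-rootLetters : {L : List (List A × A)} → ([] , c) ∈ L → c ∈ rootLetters L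
∈-rootLetters (here refl)                     = here refl
∈-rootLetters {L = ([] , _) ∷ _}    (there p∈L) = there (∈-rootLetters p∈L)
∈-rootLetters {L = (_ ∷ _ , _) ∷ _} (there p∈L) = ∈-rootLetters p∈L

module _ {a : A} {S : List A} {L L′ : List (List A × A)}
         (edgesT : ∀ p → p ∈ L ⇔ Edge (a ∷ S) p) (edgesS : ∀ p → p ∈ L′ ⇔ Edge S p) where

  private
    ∈L : ∀ {p} → Edge (a ∷ S) p → p ∈ L
    ∈L = Equivalence.from (edgesT _)

    edgeS : ∀ {p} → p ∈ L′ → Edge S p
    edgeS = Equivalence.to (edgesS _)

    l = length L
    s = length (shortenedEdges L)
    σ = length (rootLetters L)

    s+σ≡l : s + σ ≡ l
    s+σ≡l = length-shortenedEdges+rootLetters L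

  a∈rootLetters : a ∈ rootLetters L
  a∈rootLetters = ∈-rootLetters (∈L (Edge-root (here refl)))

  ∈S⇒2≤rootLetters : b ∈ S → b ≢ a → 2 ≤ length (rootLetters L)
  ∈S⇒2≤rootLetters b∈S b≢a = Unique-⊆⇒length≤ ((a≢b ∷ []) ∷ [] ∷ []) [a,b]⊆rootLetters
    where
    a≢b = λ a≡b → b≢a (sym a≡b)
    [a,b]⊆rootLetters : a ∷ [ _ ] ⊆ rootLetters L
    [a,b]⊆rootLetters (here refl)         = a∈rootLetters
    [a,b]⊆rootLetters (there (here refl)) = ∈-rootLetters (∈L (Edge-root (there b∈S)))

  edges⊆edges-∷ : ¬ ¬ L′ ⊆ L ++ shortenedEdges L
  edges⊆edges-∷ = ¬¬-⊆ λ p∈L′ → Edge-∷⁺ (edgeS p∈L′) >>= λ where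
    (inj₁ e) → return (∈-++⁺ˡ (∈L e))
    (inj₂ e) → return (∈-++⁺ʳ L (∈-shortenedEdges (∈L e)))

  edges⊆edges-∷-unary : All (λ t → ¬ ¬ t ≡ a) S → ¬ ¬ L′ ⊆ shortenedEdges L
  edges⊆edges-∷-unary unary = ¬¬-⊆ λ p∈L′ →
    ∈-shortenedEdges ∘ ∈L <$> Edge-∷⁺-unary unary (edgeS p∈L′)

  edgeCount-∷ : Unique L′ → ¬ ¬ (2 + length L′ ≤ l + l)
  edgeCount-∷ unique = ¬¬-excluded-middle >>= byLetterOtherThan-a
    where
    open ℕ.≤-Reasoning
    bound-binary : 2 ≤ σ → length L′ ≤ length (L ++ shortenedEdges L) → 2 + length L′ ≤ l + l
    bound-binary 2≤σ L′≤ = begin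
      2 + length L′   ≤⟨ ℕ.+-mono-≤ 2≤σ (ℕ.≤-trans L′≤ (ℕ.≤-reflexive (length-++ L))) ⟩
      σ + (l + s)     ≡⟨ ℕ.+-comm σ (l + s) ⟩
      l + s + σ       ≡⟨ ℕ.+-assoc l s σ ⟩
      l + (s + σ)     ≡⟨ cong (_+_ l) s+σ≡l ⟩
      l + l           ∎
    bound-unary : length L′ ≤ s → 2 + length L′ ≤ l + l
    bound-unary L′≤s = ℕ.+-mono-≤ (ℕ.≤-trans (s≤s z≤n) 1+L′≤l) 1+L′≤l
      where
      1+L′≤l : 1 + length L′ ≤ l
      1+L′≤l = begin
        1 + length L′  ≤⟨ ℕ.+-mono-≤ (∈-length a∈rootLetters) L′≤s ⟩
        σ + s          ≡⟨ ℕ.+-comm σ s ⟩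
        s + σ          ≡⟨ s+σ≡l ⟩
        l              ∎
    byLetterOtherThan-a : Dec (Any (_≢ a) S) → ¬ ¬ (2 + length L′ ≤ l + l)
    byLetterOtherThan-a (yes b≢a∈S) = let b , b∈S , b≢a = find b≢a∈S in do
      L′⊆ ← edges⊆edges-∷
      return (bound-binary (∈S⇒2≤rootLetters b∈S b≢a) (Unique-⊆⇒length≤ unique L′⊆))
    byLetterOtherThan-a (no ¬b≢a∈S) = do
      L′⊆ ← edges⊆edges-∷-unary (¬Any⇒All¬ S ¬b≢a∈S)
      return (bound-unary (Unique-⊆⇒length≤ unique L′⊆))

2+m≤n+n⇒m-n≤n-2 : ∀ m n → 2 + m ≤ n + n → + m - + n ≤ℤ + n - + 2
2+m≤n+n⇒m-n≤n-2 m n 2+m≤n+n = begin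
  + m - + n          ≡⟨ ℤ.m-n≡m⊖n m n ⟩
  m ⊖ n              ≡⟨ ℤ.+-cancelˡ-⊖ 2 m n ⟨
  (2 + m) ⊖ (2 + n)  ≤⟨ ℤ.⊖-monoˡ-≤ (2 + n) 2+m≤n+n ⟩
  (n + n) ⊖ (2 + n)  ≡⟨ cong ((n + n) ⊖_) (ℕ.+-comm 2 n) ⟩
  (n + n) ⊖ (n + 2)  ≡⟨ ℤ.+-cancelˡ-⊖ n n 2 ⟩
  n ⊖ 2              ≡⟨ ℤ.m-n≡m⊖n n 2 ⟨
  + n - + 2          ∎
  where open ℤ.≤-Reasoning

theorem3 : {A : Set} (T : List A) → 1 ≤ length T →
    (e eTail : ℕ) → EdgeCount T e → EdgeCount (drop 1 T) eTail →
    (+ eTail - + e) ≤ℤ (+ e - + 2)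
theorem3 [] () _ _ _ _
theorem3 (a ∷ S) _ _ _ (L , _ , refl , edgesT) (L′ , unique , refl , edgesS) =
  2+m≤n+n⇒m-n≤n-2 (length L′) (length L)
    (decidable-stable (_ ℕ.≤? _) (edgeCount-∷ edgesT edgesS unique))
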